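{- If $H$ is a nontrivial graph and $G=H \circ K_1$, then $\mathrm{nim}(\mathrm{DNG}(G))=1$.
   Context: The corona $H\circ K_1$ is formed from $H$ by adding, for each $v\in V(H)$, a new vertex $v'$ and a new edge $vv'$. For a graph $G=(V,E)$, a set of vertices is geodetically convex if it contains every vertex on every shortest path between two of its vertices; the convex hull $[P]$ is the smallest convex set containing $P$, and $P$ is generating if $[P]=V$. In the avoidance game $\mathrm{DNG}(G)$, two players alternately select previously-unselected vertices such that the selected set never generates; the player who cannot move loses. $\mathrm{nim}$ denotes the nim-number of an impartial game. -}

module Defs where

open import Data.Nat using (ℕ; zero; suc; _+_; _<_; _≤_)
open import Data.Fin using (Fin; splitAt; _≟_)
open import Data.Fin.Subset using (Subset; _∈_; _∉_; _∪_; ⁅_⁆; ⊥)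
open import Data.Bool using (Bool; true; false)
open import Data.Sum using (_⊎_; inj₁; inj₂)
open import Data.Product using (Σ; _×_; ∃)
open import Data.List using (List; []; _∷_)
open import Data.List.Relation.Unary.Any using (Any)
open import Relation.Nullary using (¬_)
open import Relation.Nullary.Decidable using (⌊_⌋)
open import Relation.Binary.PropositionalEquality using (_≡_)

Adjacency : ℕ → Set
Adjacency m = Fin m → Fin m → Bool

record Graph (n : ℕ) : Set where
  field
    adj    : Adjacency n
    sym    : ∀ x y → adj x y ≡ adj y x
    irrefl : ∀ x → adj x x ≡ false

-- Corona H ∘ K₁ on vertex set Fin (n + n): the first n vertices are the
-- vertices v of H, vertex (n + i) is the new pendant vertex i' attached to i.
coronaAdj : ∀ {n} → Graph n → Adjacency (n + n)
coronaAdj {n} H x y with splitAt n x | splitAt n y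
... | inj₁ a | inj₁ b = Graph.adj H a b
... | inj₁ a | inj₂ b = ⌊ a ≟ b ⌋
... | inj₂ a | inj₁ b = ⌊ a ≟ b ⌋
... | inj₂ a | inj₂ b = false

data Walk {m : ℕ} (A : Adjacency m) : Fin m → Fin m → ℕ → Set where
  here : ∀ u → Walk A u u 0
  step : ∀ {u w v k} → A u w ≡ true → Walk A w v k → Walk A u v (suc k)

verts : ∀ {m} {A : Adjacency m} {u v k} → Walk A u v k → List (Fin m)
verts (here u) = u ∷ []
verts (step {u = u} _ p) = u ∷ verts p

Shortest : ∀ {m} {A : Adjacency m} {u v k} → Walk A u v k → Set
Shortest {A = A} {u} {v} {k} _ = ∀ j → j < k → ¬ Walk A u v j

Convex : ∀ {m} → Adjacency m → Subset m → Set
Convex A C = ∀ {u v k} (p : Walk A u v k) → u ∈ C → v ∈ C → Shortest p →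
             ∀ w → Any (w ≡_) (verts p) → w ∈ C

_⊆ˢ_ : ∀ {m} → Subset m → Subset m → Set
P ⊆ˢ C = ∀ {x} → x ∈ P → x ∈ C

-- P is generating: its convex hull (the smallest convex set containing P,
-- i.e. the intersection of all convex supersets of P) is the whole vertex set.
Generating : ∀ {m} → Adjacency m → Subset m → Set
Generating A P = ∀ C → P ⊆ˢ C → Convex A C → ∀ x → x ∈ C

LegalMove : ∀ {m} → Adjacency m → Subset m → Fin m → Set
LegalMove A P v = v ∉ P × ¬ Generating A (P ∪ ⁅ v ⁆)

-- Defined by recursion on a fuel r, which must be at least the number of
-- unselected vertices (each move selects a new vertex), so that at fuel 0
-- there are no moves and the nim-number is 0.  Nim-number = mex of options.
NimIs : ∀ {m} → Adjacency m → ℕ → Subset m → ℕ → Set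
NimIs A zero P k = k ≡ 0
NimIs A (suc r) P k =
  (∀ j → j < k → ∃ λ v → LegalMove A P v × NimIs A r (P ∪ ⁅ v ⁆) j)
  × (∀ v → LegalMove A P v → ¬ NimIs A r (P ∪ ⁅ v ⁆) k)

-- nim(DNG(G)) = k for a graph on Fin m: the starting position is the empty set,
-- and fuel m suffices.
NimDNG : ∀ {m} → Adjacency m → ℕ → Set
NimDNG {m} A k = NimIs A m ⊥ k

{-# OPTIONS --safe #-}
-- Call a vertex of H ∘ K₁ essential if it is a pendant vertex v′ or an isolated
-- vertex of H.  An essential vertex e has at most one neighbour, so no shortest
-- path between two other vertices passes through e: V ∖ {e} is convex, and a set
-- avoiding e does not generate.  Conversely a set containing every essential
-- vertex generates, since a non-isolated vertex u of H with a neighbour w lies on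
-- the geodesic u′ u w w′.  Hence a move is available as long as two vertices are
-- unselected (leave some unselected essential vertex out), whereas the last one can
-- never be selected.  A position with d + 1 unselected vertices thus has
-- nim-number d mod 2, and the game starts with 2|V(H)| unselected vertices.
module Submission where

open import Defs
open import Data.Bool using (Bool; true; false)
open import Data.Bool.Properties using (¬-not) renaming (_≟_ to _≟ᵇ_)
open import Data.Empty using (⊥-elim)
open import Data.Fin using (Fin; zero; suc; splitAt; join; _≟_)
open import Data.Fin.Properties using (splitAt-join; join-splitAt; splitAt⁻¹-↑ˡ; ↑ˡ-injective; ↑ʳ-injective; any?; all?)
open import Data.Fin.Subset using (Subset; _∈_; _∉_; _∪_; ⁅_⁆; ⊥; ∁; inside; outside; ∣_∣)
open import Data.Fin.Subset.Properties
  using (x∈⁅x⁆; x∈⁅y⁆⇒x≡y; x≢y⇒x∉⁅y⁆; x∉⁅y⁆⇒x≢y; x∈∁p⇒x∉p; x∉p⇒x∈∁p; x∈p∪q⁻; x∈p∪q⁺; _∈?_; ∉⊥;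
         ∪-identityʳ; ∣∁p∣≡n∸∣p∣; ∣⊥∣≡0)
open import Data.List.Relation.Unary.Any using (Any; here; there)
open import Data.Nat using (ℕ; zero; suc; _+_; _∸_; _≤_; _<_; z≤n; s≤s)
open import Data.Nat.Properties using (<-cmp; +-suc; n≤1+n; suc-injective)
open import Data.Product using (∃; _×_; _,_)
open import Data.Sum using (_⊎_; inj₁; inj₂; [_,_]′)
open import Data.Unit using (⊤; tt)
open import Data.Vec using (_∷_)
import Data.Vec as Vec
open import Function using (_∘_)
open import Function.Bundles using (mk⇔)
open import Relation.Binary.Definitions using (tri<; tri≈; tri>)
open import Relation.Binary.PropositionalEquality using (_≡_; _≢_; refl; sym; trans; cong; cong₂; subst; module ≡-Reasoning)
open import Relation.Nullary using (¬_; yes; no; does; ¬?; contradiction)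
open import Relation.Nullary.Decidable using (⌊_⌋; _×-dec_; dec-true; does-⇔; isYes≗does; decidable-stable)
open import Relation.Unary using (Decidable)

∣∁p∣≡0⇒x∈p : ∀ {n} {p : Subset n} {x} → ∣ ∁ p ∣ ≡ 0 → x ∈ p
∣∁p∣≡0⇒x∈p {p = inside ∷ p}  {zero}  _ = Vec.here
∣∁p∣≡0⇒x∈p {p = inside ∷ p}  {suc x} e = Vec.there (∣∁p∣≡0⇒x∈p e)
∣∁p∣≡0⇒x∈p {p = outside ∷ p} ()

∣∁p∣≡1+d⇒∃x∉p : ∀ {n d} (p : Subset n) → ∣ ∁ p ∣ ≡ suc d → ∃ λ x → x ∉ p
∣∁p∣≡1+d⇒∃x∉p (outside ∷ p) _ = zero , λ ()
∣∁p∣≡1+d⇒∃x∉p (inside ∷ p)  e =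
  let (x , x∉p) = ∣∁p∣≡1+d⇒∃x∉p p e in suc x , λ { (Vec.there x∈p) → x∉p x∈p }

x∉p⇒∣∁p∣≡1+∣∁[p∪⁅x⁆]∣ : ∀ {n} (p : Subset n) {x} → x ∉ p → ∣ ∁ p ∣ ≡ suc ∣ ∁ (p ∪ ⁅ x ⁆) ∣
x∉p⇒∣∁p∣≡1+∣∁[p∪⁅x⁆]∣ (outside ∷ p) {zero}  _   = cong (λ q → suc ∣ ∁ q ∣) (sym (∪-identityʳ p))
x∉p⇒∣∁p∣≡1+∣∁[p∪⁅x⁆]∣ (inside ∷ p)  {zero}  x∉p = contradiction Vec.here x∉p
x∉p⇒∣∁p∣≡1+∣∁[p∪⁅x⁆]∣ (outside ∷ p) {suc x} x∉p =
  cong suc (x∉p⇒∣∁p∣≡1+∣∁[p∪⁅x⁆]∣ p (x∉p ∘ Vec.there))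
x∉p⇒∣∁p∣≡1+∣∁[p∪⁅x⁆]∣ (inside ∷ p)  {suc x} x∉p = x∉p⇒∣∁p∣≡1+∣∁[p∪⁅x⁆]∣ p (x∉p ∘ Vec.there)

x∉p⇒∣∁[p∪⁅x⁆]∣≡∣∁p∣-1 : ∀ {n d} {p : Subset n} {x} →
                          x ∉ p → ∣ ∁ p ∣ ≡ suc d → ∣ ∁ (p ∪ ⁅ x ⁆) ∣ ≡ d
x∉p⇒∣∁[p∪⁅x⁆]∣≡∣∁p∣-1 {p = p} x∉p e =
  suc-injective (trans (sym (x∉p⇒∣∁p∣≡1+∣∁[p∪⁅x⁆]∣ p x∉p)) e)

x∉p∧x≢y⇒x∉p∪⁅y⁆ : ∀ {n} {p : Subset n} {x y} → x ∉ p → x ≢ y → x ∉ p ∪ ⁅ y ⁆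
x∉p∧x≢y⇒x∉p∪⁅y⁆ {p = p} {y = y} x∉p x≢y = [ x∉p , x≢y ∘ x∈⁅y⁆⇒x≡y y ]′ ∘ x∈p∪q⁻ p ⁅ y ⁆

parity : ℕ → ℕ
parity zero          = 0
parity (suc zero)    = 1
parity (suc (suc d)) = parity d

parity-suc-≢ : ∀ d → parity (suc d) ≢ parity d
parity-suc-≢ zero          = λ ()
parity-suc-≢ (suc zero)    = λ ()
parity-suc-≢ (suc (suc d)) = parity-suc-≢ d

<parity-suc⇒≡parity : ∀ d {j} → j < parity (suc d) → j ≡ parity d
<parity-suc⇒≡parity zero          (s≤s z≤n) = refl
<parity-suc⇒≡parity (suc (suc d)) j<        = <parity-suc⇒≡parity d j<

parity[k+1+k]≡1 : ∀ k → parity (k + suc k) ≡ 1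
parity[k+1+k]≡1 zero    = refl
parity[k+1+k]≡1 (suc k) rewrite +-suc k (suc k) = parity[k+1+k]≡1 k

NimIs-functional : ∀ {m} {A : Adjacency m} r P {k k′} → NimIs A r P k → NimIs A r P k′ → k ≡ k′
NimIs-functional zero    _ k≡0 k′≡0 = trans k≡0 (sym k′≡0)
NimIs-functional (suc r) _ {k} {k′} (reach , avoid) (reach′ , avoid′) with <-cmp k k′
... | tri< k<k′ _ _ = let (v , legal , nim) = reach′ k k<k′ in ⊥-elim (avoid v legal nim)
... | tri≈ _ k≡k′ _ = k≡k′
... | tri> _ _ k′<k = let (v , legal , nim) = reach k′ k′<k in ⊥-elim (avoid′ v legal nim)

full⇒Generating : ∀ {m} {A : Adjacency m} {P} → (∀ x → x ∈ P) → Generating A P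
full⇒Generating x∈P _ P⊆C _ x = P⊆C (x∈P x)

MovesWhileTwoFree : ∀ {m} → Adjacency m → Set
MovesWhileTwoFree A =
  ∀ P → ¬ Generating A P → ∀ {v w} → v ∉ P → w ∉ P → v ≢ w → ∃ (LegalMove A P)

module _ {m} {A : Adjacency m} (moves : MovesWhileTwoFree A) where

  nimIs-parity : ∀ r d P → ¬ Generating A P → ∣ ∁ P ∣ ≡ suc d → d ≤ r → NimIs A r P (parity d)
  nimIs-parity zero    zero    _ _ _ _ = refl
  nimIs-parity (suc r) zero    P _ free _ =
    (λ _ ()) ,
    λ { v (v∉P , ¬gen) _ → ¬gen (full⇒Generating λ _ → ∣∁p∣≡0⇒x∈p (x∉p⇒∣∁[p∪⁅x⁆]∣≡∣∁p∣-1 v∉P free)) }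
  nimIs-parity (suc r) (suc d) P ¬gen free (s≤s d≤r) = reach , avoid
    where
    next : ∀ {v} → LegalMove A P v → NimIs A r (P ∪ ⁅ v ⁆) (parity d)
    next (v∉P , ¬gen′) = nimIs-parity r d _ ¬gen′ (x∉p⇒∣∁[p∪⁅x⁆]∣≡∣∁p∣-1 v∉P free) d≤r

    move : ∃ (LegalMove A P)
    move with ∣∁p∣≡1+d⇒∃x∉p P free
    ... | v , v∉P with ∣∁p∣≡1+d⇒∃x∉p (P ∪ ⁅ v ⁆) (x∉p⇒∣∁[p∪⁅x⁆]∣≡∣∁p∣-1 v∉P free)
    ... | w , w∉P∪v = moves P ¬gen v∉P (w∉P∪v ∘ x∈p∪q⁺ ∘ inj₁)
                        λ { refl → w∉P∪v (x∈p∪q⁺ (inj₂ (x∈⁅x⁆ v))) }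

    reach : ∀ j → j < parity (suc d) → ∃ λ v → LegalMove A P v × NimIs A r (P ∪ ⁅ v ⁆) j
    reach j j< with <parity-suc⇒≡parity d j<
    ... | refl = let (v , legal) = move in v , legal , next legal

    avoid : ∀ v → LegalMove A P v → ¬ NimIs A r (P ∪ ⁅ v ⁆) (parity (suc d))
    avoid v legal nim = parity-suc-≢ d (NimIs-functional r _ nim (next legal))

nimDNG-parity : ∀ {d} {A : Adjacency (suc d)} → MovesWhileTwoFree A → ¬ Generating A ⊥ → NimDNG A (parity d)
nimDNG-parity {d} moves ¬gen = nimIs-parity moves (suc d) d ⊥ ¬gen ∣∁⊥∣≡1+d (n≤1+n d)
  where
  ∣∁⊥∣≡1+d : ∣ ∁ (⊥ {suc d}) ∣ ≡ suc d
  ∣∁⊥∣≡1+d = trans (∣∁p∣≡n∸∣p∣ (⊥ {suc d})) (cong (suc d ∸_) (∣⊥∣≡0 (suc d)))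

AtMostOneNeighbour : ∀ {m} → Adjacency m → Fin m → Set
AtMostOneNeighbour A e = ∀ y z → A y e ≡ true → A e z ≡ true → y ≡ z

walk-shortcut : ∀ {m} {A : Adjacency m} {e} → AtMostOneNeighbour A e →
                ∀ {u v k} (p : Walk A u v k) → u ≢ e → v ≢ e → Any (e ≡_) (verts p) →
                ∃ λ j → j < k × Walk A u v j
walk-shortcut _ (here _)   u≢e _ (here e≡u) = ⊥-elim (u≢e (sym e≡u))
walk-shortcut _ (step _ _) u≢e _ (here e≡u) = ⊥-elim (u≢e (sym e≡u))
walk-shortcut {e = e} leaf (step {w = w} uw p) u≢e v≢e (there e∈p) with w ≟ e
walk-shortcut leaf (step uw (here _)) _ v≢e _ | yes refl = ⊥-elim (v≢e refl)
-- The detour u → e → y returns to u, so it can be dropped.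
walk-shortcut {A = A} leaf (step {u = u} uw (step {k = k} ey p)) _ _ _ | yes refl =
  k , n≤1+n (suc k) , subst (λ t → Walk A t _ k) (sym (leaf u _ uw ey)) p
walk-shortcut leaf (step uw p) u≢e v≢e (there e∈p) | no w≢e =
  let (j , j<k , q) = walk-shortcut leaf p w≢e v≢e e∈p in suc j , s≤s j<k , step uw q

x∈∁⁅y⁆⇒x≢y : ∀ {n} {x y : Fin n} → x ∈ ∁ ⁅ y ⁆ → x ≢ y
x∈∁⁅y⁆⇒x≢y = x∉⁅y⁆⇒x≢y ∘ x∈∁p⇒x∉p

∁⁅⁆-convex : ∀ {m} {A : Adjacency m} {e} → AtMostOneNeighbour A e → Convex A (∁ ⁅ e ⁆)
∁⁅⁆-convex {e = e} leaf p u∈ v∈ shortest w w∈p with w ≟ e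
... | no w≢e = x∉p⇒x∈∁p (x≢y⇒x∉⁅y⁆ w≢e)
... | yes refl =
  let (j , j<k , q) = walk-shortcut leaf p (x∈∁⁅y⁆⇒x≢y u∈) (x∈∁⁅y⁆⇒x≢y v∈) w∈p
  in ⊥-elim (shortest j j<k q)

leaf∉⇒¬Generating : ∀ {m} {A : Adjacency m} {e S} → AtMostOneNeighbour A e → e ∉ S → ¬ Generating A S
leaf∉⇒¬Generating {e = e} {S} leaf e∉S gen =
  x∈∁p⇒x∉p (gen (∁ ⁅ e ⁆) S⊆∁⁅e⁆ (∁⁅⁆-convex leaf) e) (x∈⁅x⁆ e)
  where
  S⊆∁⁅e⁆ : S ⊆ˢ ∁ ⁅ e ⁆
  S⊆∁⁅e⁆ x∈S = x∉p⇒x∈∁p (x≢y⇒x∉⁅y⁆ λ { refl → e∉S x∈S })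

leaves⇒movesWhileTwoFree :
  ∀ {m} {A : Adjacency m} {E : Fin m → Set} → Decidable E →
  (∀ {e} → E e → AtMostOneNeighbour A e) →
  (∀ S → (∀ {e} → E e → e ∈ S) → Generating A S) →
  MovesWhileTwoFree A
leaves⇒movesWhileTwoFree E? leaf cover P ¬gen {v} {w} v∉P w∉P v≢w
  with any? (λ e → E? e ×-dec ¬? (e ∈? P))
... | no ∄ = ⊥-elim (¬gen (cover P λ {e} Ee → decidable-stable (e ∈? P) λ e∉P → ∄ (e , Ee , e∉P)))
... | yes (e , Ee , e∉P) with e ≟ v
...   | yes refl = w , w∉P , leaf∉⇒¬Generating (leaf Ee) (x∉p∧x≢y⇒x∉p∪⁅y⁆ e∉P v≢w)
...   | no e≢v   = v , v∉P , leaf∉⇒¬Generating (leaf Ee) (x∉p∧x≢y⇒x∉p∪⁅y⁆ e∉P e≢v)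

≟-true⇒≡ : ∀ {n} {a b : Fin n} → ⌊ a ≟ b ⌋ ≡ true → a ≡ b
≟-true⇒≡ {a = a} {b} e with a ≟ b
... | yes a≡b = a≡b
≟-true⇒≡ () | no _

⌊≟⌋-refl : ∀ {n} (a : Fin n) → ⌊ a ≟ a ⌋ ≡ true
⌊≟⌋-refl a = trans (isYes≗does (a ≟ a)) (dec-true (a ≟ a) refl)

⌊≟⌋-sym : ∀ {n} (a b : Fin n) → ⌊ a ≟ b ⌋ ≡ ⌊ b ≟ a ⌋
⌊≟⌋-sym a b = begin
  ⌊ a ≟ b ⌋     ≡⟨ isYes≗does (a ≟ b) ⟩
  does (a ≟ b) ≡⟨ does-⇔ (mk⇔ sym sym) (a ≟ b) (b ≟ a) ⟩
  does (b ≟ a) ≡⟨ isYes≗does (b ≟ a) ⟨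
  ⌊ b ≟ a ⌋     ∎
  where open ≡-Reasoning

walk₀⇒≡ : ∀ {m} {A : Adjacency m} {u v} → Walk A u v 0 → u ≡ v
walk₀⇒≡ (here _) = refl

module Corona {n} (H : Graph n) where
  open Graph H renaming (sym to adj-sym)

  A : Adjacency (n + n)
  A = coronaAdj H

  -- inj₁ a is the vertex a of H, inj₂ a its pendant a′.
  adjˢ : Fin n ⊎ Fin n → Fin n ⊎ Fin n → Bool
  adjˢ (inj₁ a) (inj₁ b) = adj a b
  adjˢ (inj₁ a) (inj₂ b) = ⌊ a ≟ b ⌋
  adjˢ (inj₂ a) (inj₁ b) = ⌊ a ≟ b ⌋
  adjˢ (inj₂ _) (inj₂ _) = false

  A≡adjˢ : ∀ x y → A x y ≡ adjˢ (splitAt n x) (splitAt n y)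
  A≡adjˢ x y with splitAt n x | splitAt n y
  ... | inj₁ _ | inj₁ _ = refl
  ... | inj₁ _ | inj₂ _ = refl
  ... | inj₂ _ | inj₁ _ = refl
  ... | inj₂ _ | inj₂ _ = refl

  A-join : ∀ s t → A (join n n s) (join n n t) ≡ adjˢ s t
  A-join s t = trans (A≡adjˢ (join n n s) (join n n t)) (cong₂ adjˢ (splitAt-join n n s) (splitAt-join n n t))

  adjˢ-sym : ∀ s t → adjˢ s t ≡ adjˢ t s
  adjˢ-sym (inj₁ a) (inj₁ b) = adj-sym a b
  adjˢ-sym (inj₁ a) (inj₂ b) = ⌊≟⌋-sym a b
  adjˢ-sym (inj₂ a) (inj₁ b) = ⌊≟⌋-sym a b
  adjˢ-sym (inj₂ _) (inj₂ _) = refl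

  A-sym : ∀ x y → A x y ≡ A y x
  A-sym x y = trans (A≡adjˢ x y) (trans (adjˢ-sym (splitAt n x) (splitAt n y)) (sym (A≡adjˢ y x)))

  orig pendant : Fin n → Fin (n + n)
  orig    a = join n n (inj₁ a)
  pendant a = join n n (inj₂ a)

  Isolated : Fin n → Set
  Isolated a = ∀ b → adj a b ≡ false

  Essential : Fin n ⊎ Fin n → Set
  Essential (inj₁ a) = Isolated a
  Essential (inj₂ _) = ⊤

  essential? : Decidable Essential
  essential? (inj₁ a) = all? (λ b → adj a b ≟ᵇ false)
  essential? (inj₂ _) = yes tt

  mate : Fin n ⊎ Fin n → Fin n ⊎ Fin n
  mate (inj₁ a) = inj₂ a
  mate (inj₂ a) = inj₁ a

  essential-neighbourˢ : ∀ {s} → Essential s → ∀ t → adjˢ s t ≡ true → t ≡ mate s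
  essential-neighbourˢ {inj₁ a} isolated (inj₁ b) ab = contradiction (trans (sym ab) (isolated b)) λ ()
  essential-neighbourˢ {inj₁ a} _        (inj₂ b) ab = cong inj₂ (sym (≟-true⇒≡ ab))
  essential-neighbourˢ {inj₂ a} _        (inj₁ b) ab = cong inj₁ (sym (≟-true⇒≡ ab))

  EssentialVertex : Fin (n + n) → Set
  EssentialVertex x = Essential (splitAt n x)

  essential-neighbour : ∀ {x} → EssentialVertex x →
                        ∀ {y} → A x y ≡ true → y ≡ join n n (mate (splitAt n x))
  essential-neighbour {x} ess {y} xy = begin
    y                            ≡⟨ sym (join-splitAt n n y) ⟩
    join n n (splitAt n y)       ≡⟨ cong (join n n) (essential-neighbourˢ ess _ (trans (sym (A≡adjˢ x y)) xy)) ⟩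
    join n n (mate (splitAt n x)) ∎
    where open ≡-Reasoning

  essential⇒atMostOneNeighbour : ∀ {x} → EssentialVertex x → AtMostOneNeighbour A x
  essential⇒atMostOneNeighbour {x} ess y z yx xz =
    trans (essential-neighbour ess (trans (A-sym x y) yx)) (sym (essential-neighbour ess xz))

  pendant-essential : ∀ a → EssentialVertex (pendant a)
  pendant-essential a = subst Essential (sym (splitAt-join n n (inj₂ a))) tt

  pendant-neighbour : ∀ {a y} → A (pendant a) y ≡ true → y ≡ orig a
  pendant-neighbour {a} ay =
    trans (essential-neighbour (pendant-essential a) ay) (cong (join n n ∘ mate) (splitAt-join n n (inj₂ a)))

  orig≢pendant : ∀ {a b} → orig a ≢ pendant b
  orig≢pendant {a} {b} eq
    with trans (sym (splitAt-join n n (inj₁ a))) (trans (cong (splitAt n) eq) (splitAt-join n n (inj₂ b)))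
  ... | ()

  adjacent⇒≢ : ∀ {a b} → adj a b ≡ true → a ≢ b
  adjacent⇒≢ {a} ab refl = contradiction (trans (sym ab) (irrefl a)) λ ()

  pendant-path : ∀ {a b} → adj a b ≡ true → Walk A (pendant a) (pendant b) 3
  pendant-path {a} {b} ab =
    step (trans (A-join (inj₂ a) (inj₁ a)) (⌊≟⌋-refl a))
      (step (trans (A-join (inj₁ a) (inj₁ b)) ab)
        (step (trans (A-join (inj₁ b) (inj₂ b)) (⌊≟⌋-refl b)) (here _)))

  pendants-apart : ∀ {a b} → adj a b ≡ true → ∀ j → j < 3 → ¬ Walk A (pendant a) (pendant b) j
  pendants-apart ab 0 _ p = adjacent⇒≢ ab (↑ʳ-injective n _ _ (walk₀⇒≡ p))
  pendants-apart ab 1 _ (step a′b′ (here _)) = orig≢pendant (sym (pendant-neighbour a′b′))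
  pendants-apart {b = b} ab 2 _ (step {w = w} a′w (step wb′ (here _))) =
    adjacent⇒≢ ab (↑ˡ-injective n _ _ (trans (sym (pendant-neighbour a′w)) (pendant-neighbour b′w)))
    where
    b′w : A (pendant b) w ≡ true
    b′w = trans (A-sym (pendant b) _) wb′
  pendants-apart ab (suc (suc (suc _))) (s≤s (s≤s (s≤s ()))) _

  essentials-generate : ∀ S → (∀ {x} → EssentialVertex x → x ∈ S) → Generating A S
  essentials-generate S ess⊆S C S⊆C convex x with splitAt n x in eq
  ... | inj₂ _ = S⊆C (ess⊆S (subst Essential (sym eq) tt))
  ... | inj₁ a with any? (λ b → adj a b ≟ᵇ true)
  ...   | no ∄ = S⊆C (ess⊆S (subst Essential (sym eq) λ b → ¬-not λ ab → ∄ (b , ab)))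
  ...   | yes (b , ab) =
    convex (pendant-path ab) (S⊆C (ess⊆S (pendant-essential a))) (S⊆C (ess⊆S (pendant-essential b)))
           (pendants-apart ab) x (there (here (sym (splitAt⁻¹-↑ˡ eq))))

  corona-moves : MovesWhileTwoFree A
  corona-moves = leaves⇒movesWhileTwoFree (essential? ∘ splitAt n) essential⇒atMostOneNeighbour essentials-generate

  ⊥-nongenerating : Fin n → ¬ Generating A ⊥
  ⊥-nongenerating a =
    leaf∉⇒¬Generating (essential⇒atMostOneNeighbour (pendant-essential a)) (∉⊥ {x = pendant a})

proposition6p11 : ∀ (n : ℕ) (H : Graph n) → 2 ≤ n → NimDNG (coronaAdj H) 1
proposition6p11 (suc n) H _ =
  subst (NimDNG (coronaAdj H)) (parity[k+1+k]≡1 n) (nimDNG-parity corona-moves (⊥-nongenerating zero))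
  where open Corona H
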